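{- Let $d\ge 1$ and let $\mathcal{C}=\{0,1\}^{d+1}\setminus\{(1,1,\dots,1)\}$. Then $\mathtt{vc}(\mathcal{C})=d$, $\mathtt{vc}^\star(\mathcal{C})=\lfloor\log_2(d+1)\rfloor$, and $\mathtt{r}(\mathcal{C})=d+1$.
   Context: A concept class is $\mathcal{C}\subseteq\{0,1\}^n$ (here $n=d+1$), each $c$ a function $[n]\to\{0,1\}$. $\mathcal{C}$ shatters $A\subseteq[n]$ if all patterns in $\{0,1\}^A$ appear as restrictions of concepts; $\mathtt{vc}(\mathcal{C})$ is the largest size of a shattered set. $\mathtt{vc}^\star(\mathcal{C})$ is the largest $k$ such that some $c_1,\dots,c_k\in\mathcal{C}$ satisfy: for every $S\subseteq[k]$ there is $x\in[n]$ with $c_i(x)=1$ iff $i\in S$. Convexity space of $\mathcal{C}$: half-spaces $\mathcal{C}_{x,y}=\{c\in\mathcal{C}:c(x)=y\}$, convex sets are intersections of half-spaces, $\mathtt{conv}(P)$ is the intersection of all convex sets containing $P$. $c_1,\dots,c_k$ are Radon-independent if $\mathtt{conv}(\{c_i:i\in I\})\cap\mathtt{conv}(\{c_j:j\in J\})=\emptyset$ for every partition of $[k]$ into nonempty $I,J$; $\mathtt{r}(\mathcal{C})$ is the maximum size of a Radon-independent set. -}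

module Defs where

open import Data.Nat using (ℕ; suc; _≤_)
open import Data.Bool using (Bool; true; false)
open import Data.Fin using (Fin)
open import Data.Fin.Subset using (Subset; _∈_; ∣_∣; ∁; Nonempty)
open import Data.Vec using (lookup)
open import Data.Product using (Σ; ∃; _×_)
open import Relation.Nullary using (¬_)
open import Relation.Binary.PropositionalEquality using (_≡_)
open import Function.Definitions using (Injective)

Concept : ℕ → Set
Concept n = Fin n → Bool

ConceptClass : ℕ → Set₁
ConceptClass n = Concept n → Set

Shatters : ∀ {n} → ConceptClass n → Subset n → Set
Shatters {n} C A = (p : Fin n → Bool) →
  ∃ λ c → C c × (∀ x → x ∈ A → c x ≡ p x)

IsVC : ∀ {n} → ConceptClass n → ℕ → Set
IsVC {n} C k =
  (Σ (Subset n) λ A → Shatters C A × ∣ A ∣ ≡ k) ×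
  (∀ (A : Subset n) → Shatters C A → ∣ A ∣ ≤ k)

DualShattered : ∀ {n m} → ConceptClass n → (Fin m → Concept n) → Set
DualShattered {n} {m} C cs =
  (∀ i → C (cs i)) ×
  ((S : Subset m) → ∃ λ (x : Fin n) → ∀ i → cs i x ≡ lookup S i)

IsDualVC : ∀ {n} → ConceptClass n → ℕ → Set
IsDualVC {n} C k =
  (Σ (Fin k → Concept n) λ cs → DualShattered C cs) ×
  (∀ m (cs : Fin m → Concept n) → DualShattered C cs → m ≤ k)

-- Half-space C_{x,y} = {c ∈ C : c x = y}.
-- A family of half-spaces is given by F : Fin n → Bool → Bool
-- (F x y ≡ true means C_{x,y} belongs to the family); every set of
-- half-spaces arises this way.  The convex set determined by F is the
-- intersection of the family (the empty intersection being C itself).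
InIntersection : ∀ {n} → ConceptClass n → (Fin n → Bool → Bool) → Concept n → Set
InIntersection C F c = C c × (∀ x y → F x y ≡ true → c x ≡ y)

Conv : ∀ {n} → ConceptClass n → (Concept n → Set) → Concept n → Set
Conv {n} C P c =
  (F : Fin n → Bool → Bool) →
  (∀ p → P p → InIntersection C F p) → InIntersection C F c

Image : ∀ {n k} → (Fin k → Concept n) → Subset k → Concept n → Set
Image cs I c = ∃ λ i → i ∈ I × cs i ≡ c

RadonIndependent : ∀ {n k} → ConceptClass n → (Fin k → Concept n) → Set
RadonIndependent {n} {k} C cs =
  (∀ i → C (cs i)) × Injective _≡_ _≡_ cs ×
  ((I : Subset k) → Nonempty I → Nonempty (∁ I) →
    ¬ (∃ λ c → Conv C (Image cs I) c × Conv C (Image cs (∁ I)) c))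

IsRadon : ∀ {n} → ConceptClass n → ℕ → Set
IsRadon {n} C k =
  (Σ (Fin k → Concept n) λ cs → RadonIndependent C cs) ×
  (∀ m (cs : Fin m → Concept n) → RadonIndependent C cs → m ≤ k)

AllButOnes : (d : ℕ) → ConceptClass (suc d)
AllButOnes d c = ¬ (∀ x → c x ≡ true)

-- The all-ones vector is the only concept missing, so C shatters every set avoiding a
-- coordinate but not the whole domain, and a dually shattered family of m concepts is the
-- same as an injection of the 2^m subsets of [m] into the domain (the empty subset's point
-- keeps every member of the family out of the all-ones vector). For the Radon number, the
-- d+1 concepts with a single zero are independent: a point in both hulls of a partition is 1
-- at every coordinate. Conversely, every member c_i of a Radon-independent family has a
-- coordinate where it differs from all others (otherwise c_i is in the hull of the rest),
-- and with at least three members no two of them can share such a coordinate, as only two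
-- bit values exist.
module Submission where

open import Defs
open import Data.Nat using (ℕ; suc; _≤_)
open import Data.Nat.Logarithm using (⌊log₂_⌋)
open import Data.Product using (_×_)

open import Data.Bool using (Bool; true; false; not; _∧_)
import Data.Bool as Bool
open import Data.Bool.Properties using (∧-identityʳ; ∧-zeroʳ; ¬-not)
open import Data.Fin using (Fin; zero; suc; _≟_; splitAt; _↑ˡ_; punchIn)
open import Data.Fin.Properties using (2↔Bool; punchInᵢ≢i; splitAt-↑ˡ; all?; any?; ¬∀⟶∃¬; injective⇒≤)
open import Data.Fin.Subset using (Subset; _∈_; _∉_; _⊆_; ∣_∣; ∁; ⁅_⁆; Nonempty; ⊥)
open import Data.Fin.Subset.Properties
  using (_∈?_; x∈⁅x⁆; x≢y⇒x∉⁅y⁆; x∉⁅y⁆⇒x≢y; x∈⁅y⁆⇒x≡y; x∈p⇒x∉∁p; x∉p⇒x∈∁p; x∈∁p⇒x∉p;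
         ∣∁p∣≡n∸∣p∣; ∣⁅x⁆∣≡1; p⊆q⇒∣p∣≤∣q∣)
open import Data.Nat using (zero; _+_; _*_; _^_; _∸_; z≤n; s≤s; ⌊_/2⌋)
open import Data.Nat.Logarithm using (⌊log₂⌋-mono-≤; ⌊log₂⌊n/2⌋⌋≡⌊log₂n⌋∸1; ⌊log₂[2^n]⌋≡n)
open import Data.Nat.Properties
  using (≤-trans; ≤-reflexive; +-monoʳ-≤; *-monoʳ-≤; +-identityʳ; ⌊n/2⌋≤⌈n/2⌉; ⌊n/2⌋+⌈n/2⌉≡n;
         m≤n⇒∃[o]m+o≡n; module ≤-Reasoning)
open import Data.Product using (Σ; ∃; _,_; proj₁; proj₂)
open import Data.Sum using ([_,_]′)
open import Data.Vec using (Vec; lookup; tabulate)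
open import Data.Vec.Properties using (tabulate∘lookup; tabulate-cong; lookup-replicate)
open import Data.Vec.Recursive using (lift↔; Fin[m^n]↔Fin[m]^n)
open import Data.Vec.Recursive.Properties using (↔Vec)
open import Function using (_∘_; const)
open import Function.Bundles using (_↔_; Inverse; Injection; Surjection)
open import Function.Definitions using (Injective; StrictlySurjective)
open import Function.Properties.Inverse using (↔-trans; ↔⇒↣; ↔⇒↠)
open import Relation.Binary.PropositionalEquality
  using (_≡_; _≢_; refl; sym; trans; cong; cong₂; subst; module ≡-Reasoning)
open import Relation.Nullary using (¬_; Dec; yes; no; does; ¬?; contradiction)
open import Relation.Nullary.Decidable using (_×-dec_; dec-true; dec-false; decidable-stable)

2^⌊log₂[1+n]⌋≤1+n : ∀ n → 2 ^ ⌊log₂ suc n ⌋ ≤ suc n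
2^⌊log₂[1+n]⌋≤1+n n = bound _ n refl
  where
  ⌊n/2⌋+⌊n/2⌋≤n : ∀ n → ⌊ n /2⌋ + ⌊ n /2⌋ ≤ n
  ⌊n/2⌋+⌊n/2⌋≤n n = ≤-trans (+-monoʳ-≤ ⌊ n /2⌋ (⌊n/2⌋≤⌈n/2⌉ n)) (≤-reflexive (⌊n/2⌋+⌈n/2⌉≡n n))

  bound : ∀ k n → ⌊log₂ suc n ⌋ ≡ k → 2 ^ k ≤ suc n
  bound zero    n       _  = s≤s z≤n
  bound (suc k) (suc n) eq = begin
    2 * 2 ^ k                 ≤⟨ *-monoʳ-≤ 2 (bound k ⌊ n /2⌋ halved) ⟩
    2 * suc ⌊ n /2⌋           ≡⟨ cong (suc ⌊ n /2⌋ +_) (+-identityʳ _) ⟩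
    suc ⌊ n /2⌋ + suc ⌊ n /2⌋ ≤⟨ ⌊n/2⌋+⌊n/2⌋≤n (suc (suc n)) ⟩
    suc (suc n)               ∎
    where
    open ≤-Reasoning
    halved : ⌊log₂ suc ⌊ n /2⌋ ⌋ ≡ k
    halved = trans (⌊log₂⌊n/2⌋⌋≡⌊log₂n⌋∸1 (suc (suc n))) (cong (_∸ 1) eq)

2^m≤n⇒m≤⌊log₂n⌋ : ∀ {m n} → 2 ^ m ≤ n → m ≤ ⌊log₂ n ⌋
2^m≤n⇒m≤⌊log₂n⌋ {m} 2^m≤n = subst (_≤ _) (⌊log₂[2^n]⌋≡n m) (⌊log₂⌋-mono-≤ 2^m≤n)

Fin[2^n]↔Subset : ∀ n → Fin (2 ^ n) ↔ Subset n
Fin[2^n]↔Subset n = ↔-trans (Fin[m^n]↔Fin[m]^n 2 n) (↔-trans (lift↔ n 2↔Bool) (↔Vec n))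

≤⇒strictlySurjective : ∀ {a} {A : Set a} {m n} → m ≤ n → A →
  (f : Fin m → A) → StrictlySurjective _≡_ f → Σ (Fin n → A) (StrictlySurjective _≡_)
≤⇒strictlySurjective {m = m} m≤n default f f-surj with m≤n⇒∃[o]m+o≡n m≤n
... | o , refl = g , g-surj
  where
  g : Fin (m + o) → _
  g = [ f , const default ]′ ∘ splitAt m
  g-surj : StrictlySurjective _≡_ g
  g-surj y with i , fi≡y ← f-surj y = i ↑ˡ o , trans (cong [ f , const default ]′ (splitAt-↑ˡ m i o)) fi≡y

2^k≤n⇒Fin↠Subset : ∀ {k n} → 2 ^ k ≤ n → Σ (Fin n → Subset k) (StrictlySurjective _≡_)
2^k≤n⇒Fin↠Subset {k} 2^k≤n =
  ≤⇒strictlySurjective 2^k≤n ⊥ (Surjection.to decode) (Surjection.strictlySurjective decode)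
  where
  decode : Surjection _ _
  decode = ↔⇒↠ (Fin[2^n]↔Subset k)

lookup-ext : ∀ {a} {A : Set a} {n} (xs ys : Vec A n) → (∀ i → lookup xs i ≡ lookup ys i) → xs ≡ ys
lookup-ext xs ys pointwise = begin
  xs                   ≡⟨ tabulate∘lookup xs ⟨
  tabulate (lookup xs) ≡⟨ tabulate-cong pointwise ⟩
  tabulate (lookup ys) ≡⟨ tabulate∘lookup ys ⟩
  ys                   ∎
  where open ≡-Reasoning

dualShattered⇒2^m≤n : ∀ {n m} {C : ConceptClass n} {cs : Fin m → Concept n} →
  DualShattered C cs → 2 ^ m ≤ n
dualShattered⇒2^m≤n {n} {m} {cs = cs} (_ , shattered) =
  injective⇒≤ {f = witness ∘ Inverse.to decode} λ same → decode-injective (witness-injective same)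
  where
  decode : Fin (2 ^ m) ↔ Subset m
  decode = Fin[2^n]↔Subset m
  decode-injective : Injective _≡_ _≡_ (Inverse.to decode)
  decode-injective = Injection.injective (↔⇒↣ decode)
  witness : Subset m → Fin n
  witness = proj₁ ∘ shattered
  witness-injective : Injective _≡_ _≡_ witness
  witness-injective {S} {S′} same = lookup-ext S S′ λ i →
    trans (sym (proj₂ (shattered S) i)) (trans (cong (cs i) same) (proj₂ (shattered S′) i))

halfSpace : ∀ {n} → Fin n → Bool → Fin n → Bool → Bool
halfSpace x y x′ y′ = does (x′ ≟ x) ∧ does (y′ Bool.≟ y)

module _ {n} {C : ConceptClass n} {P : Concept n → Set} (P⊆C : ∀ p → P p → C p) where

  Conv-extensive : ∀ {c} → P c → Conv C P c
  Conv-extensive Pc F P⊆F = P⊆F _ Pc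

  Conv⊆C : ∀ {c} → Conv C P c → C c
  Conv⊆C c∈conv = proj₁ (c∈conv (λ _ _ → false) λ p Pp → P⊆C p Pp , λ _ _ ())

  Conv⊆halfSpace : ∀ {x y c} → (∀ p → P p → p x ≡ y) → Conv C P c → c x ≡ y
  Conv⊆halfSpace {x} {y} P⊆halfSpace c∈conv =
    proj₂ (c∈conv (halfSpace x y) P⊆F) x y (cong₂ _∧_ (dec-true (x ≟ x) refl) (dec-true (y Bool.≟ y) refl))
    where
    P⊆F : ∀ p → P p → InIntersection C (halfSpace x y) p
    P⊆F p Pp = P⊆C p Pp , inHalfSpace
      where
      inHalfSpace : ∀ x′ y′ → halfSpace x y x′ y′ ≡ true → p x′ ≡ y′
      inHalfSpace x′ y′ inF with x′ ≟ x | y′ Bool.≟ y | inF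
      ... | yes refl | yes refl | _ = P⊆halfSpace p Pp
      ... | yes _    | no _     | ()
      ... | no _     | _        | ()

  attainedPointwise⇒∈Conv : ∀ {c} → C c → (∀ x → ∃ λ p → P p × p x ≡ c x) → Conv C P c
  attainedPointwise⇒∈Conv Cc attained F P⊆F = Cc , λ x y inF →
    let p , Pp , px≡cx = attained x in trans (sym px≡cx) (proj₂ (P⊆F p Pp) x y inF)

Image⊆ : ∀ {n k} {C : ConceptClass n} {cs : Fin k → Concept n} → (∀ i → C (cs i)) →
  ∀ {I} p → Image cs I p → C p
Image⊆ cs∈C _ (i , _ , refl) = cs∈C i

thirdIndex : ∀ {m} (i i′ : Fin (3 + m)) → ∃ λ j → j ≢ i × j ≢ i′
thirdIndex zero          zero          = suc zero , (λ ()) , (λ ())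
thirdIndex zero          (suc zero)    = suc (suc zero) , (λ ()) , (λ ())
thirdIndex zero          (suc (suc _)) = suc zero , (λ ()) , (λ ())
thirdIndex (suc zero)    zero          = suc (suc zero) , (λ ()) , (λ ())
thirdIndex (suc zero)    (suc zero)    = zero , (λ ()) , (λ ())
thirdIndex (suc zero)    (suc (suc _)) = zero , (λ ()) , (λ ())
thirdIndex (suc (suc _)) zero          = suc zero , (λ ()) , (λ ())
thirdIndex (suc (suc _)) (suc _)       = zero , (λ ()) , (λ ())

PrivateCoordinate : ∀ {n m} → (Fin m → Concept n) → Fin m → Fin n → Set
PrivateCoordinate cs i x = ∀ j → j ≢ i → cs j x ≢ cs i x

shared? : ∀ {n m} (cs : Fin m → Concept n) i x → Dec (∃ λ j → j ≢ i × cs j x ≡ cs i x)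
shared? cs i x = any? λ j → ¬? (j ≟ i) ×-dec cs j x Bool.≟ cs i x

radonIndependent⇒privateCoordinate : ∀ {n m} {C : ConceptClass n} {cs : Fin (2 + m) → Concept n} →
  RadonIndependent C cs → ∀ i → ∃ (PrivateCoordinate cs i)
radonIndependent⇒privateCoordinate {n} {C = C} {cs} (cs∈C , _ , radon) i
  with all? (shared? cs i)
... | yes shared = contradiction (cs i , Conv-extensive (Image⊆ cs∈C) (i , x∈⁅x⁆ i , refl) , inConvOfOthers)
                     (radon ⁅ i ⁆ (i , x∈⁅x⁆ i) (punchIn i zero , ∈∁⁅i⁆ (punchInᵢ≢i i zero)))
  where
  ∈∁⁅i⁆ : ∀ {j} → j ≢ i → j ∈ ∁ ⁅ i ⁆
  ∈∁⁅i⁆ = x∉p⇒x∈∁p ∘ x≢y⇒x∉⁅y⁆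
  inConvOfOthers : Conv C (Image cs (∁ ⁅ i ⁆)) (cs i)
  inConvOfOthers = attainedPointwise⇒∈Conv (Image⊆ cs∈C) (cs∈C i) λ x →
    let j , j≢i , agree = shared x in cs j , (j , ∈∁⁅i⁆ j≢i , refl) , agree
... | no ¬shared with x , notShared ← ¬∀⟶∃¬ n _ (shared? cs i) ¬shared
  = x , λ j j≢i agree → notShared (j , j≢i , agree)

radonIndependent⇒≤ : ∀ {n m} {C : ConceptClass n} {cs : Fin m → Concept n} →
  2 ≤ n → RadonIndependent C cs → m ≤ n
radonIndependent⇒≤ {m = 0} _   _ = z≤n
radonIndependent⇒≤ {m = 1} 2≤n _ = ≤-trans (s≤s z≤n) 2≤n
radonIndependent⇒≤ {m = 2} 2≤n _ = 2≤n
radonIndependent⇒≤ {n} {m = suc (suc (suc _))} {cs = cs} _ independent =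
  injective⇒≤ {f = coordinate} coordinate-injective
  where
  coordinate : Fin _ → Fin n
  coordinate = proj₁ ∘ radonIndependent⇒privateCoordinate independent
  isPrivate : ∀ i → PrivateCoordinate cs i (coordinate i)
  isPrivate = proj₂ ∘ radonIndependent⇒privateCoordinate independent

  -- At a common private coordinate, cs i′ and cs j both equal not (cs i), so they agree there.
  coordinate-injective : Injective _≡_ _≡_ coordinate
  coordinate-injective {i} {i′} same = decidable-stable (i ≟ i′) λ i≢i′ →
    let j , j≢i , j≢i′ = thirdIndex i i′
    in contradiction (trans (¬-not (isPrivate i j j≢i)) (sym (¬-not (isPrivate i i′ (i≢i′ ∘ sym)))))
         (subst (λ y → cs j y ≢ cs i′ y) (sym same) (isPrivate i′ j j≢i′))

AllButOnes-intro : ∀ {d} {c : Concept (suc d)} x → c x ≡ false → AllButOnes d c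
AllButOnes-intro x cx≡false allOnes = contradiction (trans (sym (allOnes x)) cx≡false) λ ()

coSingleton : ∀ {n} → Fin n → Concept n
coSingleton i x = not (does (x ≟ i))

coSingleton-self : ∀ {n} (i : Fin n) → coSingleton i i ≡ false
coSingleton-self i = cong not (dec-true (i ≟ i) refl)

coSingleton-≢ : ∀ {n} {i x : Fin n} → x ≢ i → coSingleton i x ≡ true
coSingleton-≢ {i = i} {x} x≢i = cong not (dec-false (x ≟ i) x≢i)

coSingleton-injective : ∀ {n} → Injective _≡_ _≡_ (coSingleton {n})
coSingleton-injective {x = i} {j} eq = decidable-stable (i ≟ j) λ i≢j →
  contradiction (trans (sym (coSingleton-≢ (i≢j ∘ sym))) (trans (cong (λ c → c j) eq) (coSingleton-self j))) λ ()

∣∁⁅x⁆∣≡n : ∀ {n} (x : Fin (suc n)) → ∣ ∁ ⁅ x ⁆ ∣ ≡ n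
∣∁⁅x⁆∣≡n {n} x = trans (∣∁p∣≡n∸∣p∣ ⁅ x ⁆) (cong (suc n ∸_) (∣⁅x⁆∣≡1 x))

shatters-∁⁅x⁆ : ∀ {d} (x : Fin (suc d)) → Shatters (AllButOnes d) (∁ ⁅ x ⁆)
shatters-∁⁅x⁆ x p = (λ y → p y ∧ coSingleton x y) , AllButOnes-intro x zeroAtx , agree
  where
  zeroAtx : p x ∧ coSingleton x x ≡ false
  zeroAtx = trans (cong (p x ∧_) (coSingleton-self x)) (∧-zeroʳ (p x))
  agree : ∀ y → y ∈ ∁ ⁅ x ⁆ → p y ∧ coSingleton x y ≡ p y
  agree y y∈∁⁅x⁆ = trans (cong (p y ∧_) (coSingleton-≢ (x∉⁅y⁆⇒x≢y (x∈∁p⇒x∉p y∈∁⁅x⁆)))) (∧-identityʳ (p y))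

shattered⇒missesPoint : ∀ {d A} → Shatters (AllButOnes d) A → ∃ λ x → x ∉ A
shattered⇒missesPoint {d} {A} shatters = ¬∀⟶∃¬ (suc d) _ (_∈? A) λ all∈A →
  let c , c∈C , agree = shatters (const true) in c∈C λ x → agree x (all∈A x)

shattered⇒∣A∣≤d : ∀ {d A} → Shatters (AllButOnes d) A → ∣ A ∣ ≤ d
shattered⇒∣A∣≤d {A = A} shatters with x , x∉A ← shattered⇒missesPoint shatters =
  ≤-trans (p⊆q⇒∣p∣≤∣q∣ A⊆∁⁅x⁆) (≤-reflexive (∣∁⁅x⁆∣≡n x))
  where
  A⊆∁⁅x⁆ : A ⊆ ∁ ⁅ x ⁆
  A⊆∁⁅x⁆ y∈A = x∉p⇒x∈∁p λ y∈⁅x⁆ → x∉A (subst (_∈ A) (x∈⁅y⁆⇒x≡y x y∈⁅x⁆) y∈A)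

dualShattered-AllButOnes : ∀ {d k} → 2 ^ k ≤ suc d → Σ (Fin k → Concept (suc d)) (DualShattered (AllButOnes d))
dualShattered-AllButOnes {d} {k} 2^k≤1+d
  with g , g-surjective ← 2^k≤n⇒Fin↠Subset 2^k≤1+d = cs , cs∈C , shattered
  where
  cs : Fin k → Concept (suc d)
  cs i x = lookup (g x) i
  shattered : (S : Subset k) → ∃ λ x → ∀ i → cs i x ≡ lookup S i
  shattered S with x , gx≡S ← g-surjective S = x , λ i → cong (λ T → lookup T i) gx≡S
  cs∈C : ∀ i → AllButOnes d (cs i)
  cs∈C i with x , onEmpty ← shattered ⊥ = AllButOnes-intro x (trans (onEmpty i) (lookup-replicate i false))

coSingleton∈AllButOnes : ∀ {d} (i : Fin (suc d)) → AllButOnes d (coSingleton i)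
coSingleton∈AllButOnes i = AllButOnes-intro i (coSingleton-self i)

Conv-coSingletons-outside : ∀ {d I c x} → x ∉ I → Conv (AllButOnes d) (Image coSingleton I) c → c x ≡ true
Conv-coSingletons-outside {I = I} x∉I = Conv⊆halfSpace (Image⊆ coSingleton∈AllButOnes) λ where
  _ (j , j∈I , refl) → coSingleton-≢ λ x≡j → x∉I (subst (_∈ I) (sym x≡j) j∈I)

radonIndependent-coSingletons : ∀ {d} → RadonIndependent (AllButOnes d) coSingleton
radonIndependent-coSingletons {d} = coSingleton∈AllButOnes , coSingleton-injective , noCommonPoint
  where
  noCommonPoint : ∀ I → Nonempty I → Nonempty (∁ I) →
    ¬ (∃ λ c → Conv (AllButOnes d) (Image coSingleton I) c × Conv (AllButOnes d) (Image coSingleton (∁ I)) c)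
  noCommonPoint I _ _ (c , c∈convI , c∈conv∁I) = Conv⊆C (Image⊆ coSingleton∈AllButOnes) c∈convI allOnes
    where
    allOnes : ∀ x → c x ≡ true
    allOnes x with x ∈? I
    ... | yes x∈I = Conv-coSingletons-outside (x∈p⇒x∉∁p x∈I) c∈conv∁I
    ... | no  x∉I = Conv-coSingletons-outside x∉I c∈convI

proposition7 : (d : ℕ) → 1 ≤ d →
    IsVC (AllButOnes d) d × IsDualVC (AllButOnes d) ⌊log₂ suc d ⌋ × IsRadon (AllButOnes d) (suc d)
proposition7 d 1≤d = vc , dualVC , radon
  where
  vc : IsVC (AllButOnes d) d
  vc = (∁ ⁅ zero ⁆ , shatters-∁⁅x⁆ zero , ∣∁⁅x⁆∣≡n zero) , λ _ → shattered⇒∣A∣≤d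

  dualVC : IsDualVC (AllButOnes d) ⌊log₂ suc d ⌋
  dualVC = dualShattered-AllButOnes (2^⌊log₂[1+n]⌋≤1+n d) , λ _ _ → 2^m≤n⇒m≤⌊log₂n⌋ ∘ dualShattered⇒2^m≤n {C = AllButOnes d}

  radon : IsRadon (AllButOnes d) (suc d)
  radon = (coSingleton , radonIndependent-coSingletons) , λ _ _ → radonIndependent⇒≤ (s≤s 1≤d)
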